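{- Let $X$ be a finite set with $|X|=n$ and let $S\subseteq X^3$ be an orthogonal array of degree $3$ and strength $2$ on $X$. For any $r$-coloring of $X$ with color classes $X_1,\dots,X_r$ and densities $c_i=|X_i|/n$, $$2|M|-|R|=n^2\Big(3\sum_{i=1}^r c_i^2-1\Big),$$ where $M$ is the set of monochromatic vectors of $S$ and $R$ is the set of rainbow vectors of $S$.
   Context: $S\subseteq X^3$ is an orthogonal array of degree 3 and strength 2 on $X$ if for any two distinct coordinate positions $i<j$ in $\{1,2,3\}$ and any $a,b\in X$ there is exactly one $(y_1,y_2,y_3)\in S$ with $y_i=a$, $y_j=b$. A vector is monochromatic if all its coordinates lie in the same color class, and rainbow if its three coordinates lie in three pairwise distinct color classes. -}

module Defs where

open import Data.Nat using (ℕ)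
open import Data.Fin using (Fin; _≟_)
open import Data.Bool using (Bool; true; _∧_; not)
open import Data.Product using (_×_; _,_; ∃)
open import Data.List using (List; allFin; cartesianProduct; filter; length; map; foldr)
open import Data.Integer using (ℤ; +_) renaming (_-_ to _-ℤ_; _*_ to _*ℤ_)
open import Data.Rational using (ℚ; 0ℚ; _+_)
open import Relation.Binary.PropositionalEquality using (_≡_)
open import Relation.Nullary.Decidable using (⌊_⌋; does)

-- The ground set X is taken to be Fin n (so |X| = n).
Triple : ℕ → Set
Triple n = Fin n × Fin n × Fin n

Sub3 : ℕ → Set
Sub3 n = Triple n → Bool

IsOrthogonalArray-3-2 : {n : ℕ} → Sub3 n → Set
IsOrthogonalArray-3-2 {n} S =
    (∀ (a b : Fin n) → ∃ λ z → S (a , b , z) ≡ true × (∀ z' → S (a , b , z') ≡ true → z' ≡ z))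
  × (∀ (a b : Fin n) → ∃ λ y → S (a , y , b) ≡ true × (∀ y' → S (a , y' , b) ≡ true → y' ≡ y))
  × (∀ (a b : Fin n) → ∃ λ x → S (x , a , b) ≡ true × (∀ x' → S (x' , a , b) ≡ true → x' ≡ x))

allTriples : (n : ℕ) → List (Triple n)
allTriples n = cartesianProduct (allFin n) (cartesianProduct (allFin n) (allFin n))

-- a coloring of X with r colours: color class X_i = col ⁻¹(i)
sameColor : {n r : ℕ} → (Fin n → Fin r) → Fin n → Fin n → Bool
sameColor col x y = does (col x ≟ col y)

isMonochromatic : {n r : ℕ} → (Fin n → Fin r) → Triple n → Bool
isMonochromatic col (x , y , z) = sameColor col x y ∧ sameColor col y z

isRainbow : {n r : ℕ} → (Fin n → Fin r) → Triple n → Bool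
isRainbow col (x , y , z) =
  not (sameColor col x y) ∧ not (sameColor col y z) ∧ not (sameColor col x z)

monoVectors : {n r : ℕ} → Sub3 n → (Fin n → Fin r) → List (Triple n)
monoVectors {n} S col = filter (λ t → Data.Bool._≟_ (S t ∧ isMonochromatic col t) true) (allTriples n)

rainbowVectors : {n r : ℕ} → Sub3 n → (Fin n → Fin r) → List (Triple n)
rainbowVectors {n} S col = filter (λ t → Data.Bool._≟_ (S t ∧ isRainbow col t) true) (allTriples n)

classSize : {n r : ℕ} → (Fin n → Fin r) → Fin r → ℕ
classSize {n} col i = length (filter (λ x → col x ≟ i) (allFin n))

sumℚ : (r : ℕ) → (Fin r → ℚ) → ℚ
sumℚ r f = foldr _+_ 0ℚ (map f (allFin r))

module Submission where

-- For any three colours a, b, c exactly one of four things happens: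
-- all equal, exactly one of the pairs ab, bc, ac agrees, or all differ.
-- Counting agreeing pairs therefore gives the pointwise identity
--   2·[abc monochromatic] + 1 = [rainbow] + [a=b] + [b=c] + [a=c].
-- Summing it over the vectors of S: S has n² vectors, and since every line
-- of S (two coordinates fixed) holds exactly one vector, the vectors of S
-- whose coordinates i, j have the same colour correspond to the ordered
-- monochromatic pairs of X, of which there are Σ s_i².  Hence
--   2|M| + n² = |R| + 3 Σ s_i²   in ℕ,
-- and the theorem follows by dividing by n² in ℚ.

open import Defs
open import Data.Nat using (ℕ; NonZero; _*_)
open import Data.Fin using (Fin)
open import Data.List using (length)
open import Data.Integer using (+_)
open import Data.Rational using (ℚ; _/_; _-_; 1ℚ) renaming (_*_ to _*ℚ_)
open import Relation.Binary.PropositionalEquality using (_≡_)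

open import Algebra.Bundles using (Monoid; CommutativeRing)
open import Data.Nat using (zero; suc; _+_)
import Data.Nat.Properties as ℕP
open import Data.Nat.ListAction using (sum)
open import Data.Fin as Fin using (punchIn)
open import Data.Fin.Properties using (punchInᵢ≢i)
open import Data.Bool using (Bool; true; false; _∧_; not) renaming (_≟_ to _≟ᵇ_)
open import Data.Bool.Properties using (∧-identityʳ)
open import Data.Product using (_×_; _,_; ∃; proj₁; proj₂)
open import Data.List using (List; []; _∷_; _++_; map; filter; tabulate; allFin; cartesianProduct; foldr)
open import Data.List.Properties using (map-++; map-tabulate; map-∘; map-cong)
open import Data.Nat.ListAction.Properties using (sum-++)
import Algebra.Definitions.RawMonoid as RawMonoid
open import Data.Empty using (⊥-elim)
open import Relation.Nullary using (Dec; yes; no; does)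
open import Relation.Nullary.Decidable using (dec-true)
open import Relation.Binary.Definitions using (DecidableEquality)
open import Relation.Binary.PropositionalEquality using (refl; sym; trans; cong; cong₂; _≢_; module ≡-Reasoning)
import Data.Integer as ℤ
import Data.Integer.Properties as ℤP
import Data.Rational as ℚ
import Data.Rational.Properties as ℚP
import Data.Rational.Unnormalised as ℚᵘ
open ℚᵘ using (mkℚᵘ; *≡*)
import Data.Rational.Unnormalised.Properties as ℚᵘP
open import Data.Rational.Solver using (module +-*-Solver)
open import Data.Nat.Tactic.RingSolver using (solve-∀)

open import Algebra.Properties.Semiring.Sum ℕP.+-*-semiring
  using (sum-syntax; sum-cong-≗; sum-remove; sum-replicate-zero; ∑-distrib-+; ∑-comm; *-distribˡ-sum; *-distribʳ-sum)
  renaming (sum to ∑)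
import Algebra.Properties.Semiring.Sum
module ℚΣ = Algebra.Properties.Semiring.Sum (CommutativeRing.semiring ℚP.+-*-commutativeRing)

open ≡-Reasoning

χ : Bool → ℕ
χ true  = 1
χ false = 0

χ-∧ : ∀ a b → χ (a ∧ b) ≡ χ a * χ b
χ-∧ true  b = sym (ℕP.*-identityˡ (χ b))
χ-∧ false b = refl

does⇒witness : ∀ {p} {P : Set p} (P? : Dec P) → does P? ≡ true → P
does⇒witness (yes p) _ = p
does⇒witness (no _) ()

UniqueTrue : ∀ {n} → (Fin n → Bool) → Fin n → Set
UniqueTrue g z₀ = g z₀ ≡ true × (∀ z → g z ≡ true → z ≡ z₀)

∑-point : ∀ {n} (f : Fin n → ℕ) (z₀ : Fin n) → (∀ z → z ≢ z₀ → f z ≡ 0) → ∑ f ≡ f z₀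
∑-point {suc n} f z₀ vanish = begin
  ∑ f                                ≡⟨ sum-remove {i = z₀} f ⟩
  f z₀ + ∑ (λ j → f (punchIn z₀ j))  ≡⟨ cong (_+_ (f z₀)) rest-vanishes ⟩
  f z₀ + 0                           ≡⟨ ℕP.+-identityʳ (f z₀) ⟩
  f z₀                               ∎
  where
  rest-vanishes : ∑ (λ j → f (punchIn z₀ j)) ≡ 0
  rest-vanishes = trans (sum-cong-≗ (λ j → vanish _ (punchInᵢ≢i z₀ j))) (sum-replicate-zero n)

∑-select : ∀ {n} (g : Fin n → Bool) (h : Fin n → ℕ) {z₀} → UniqueTrue g z₀ →
  ∑[ z < n ] (χ (g z) * h z) ≡ h z₀
∑-select g h {z₀} (gz₀ , only) = begin
  ∑[ z < _ ] (χ (g z) * h z) ≡⟨ ∑-point _ z₀ vanish ⟩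
  χ (g z₀) * h z₀            ≡⟨ cong (λ b → χ b * h z₀) gz₀ ⟩
  1 * h z₀                   ≡⟨ ℕP.*-identityˡ (h z₀) ⟩
  h z₀                       ∎
  where
  vanish : ∀ z → z ≢ z₀ → χ (g z) * h z ≡ 0
  vanish z z≢z₀ with g z in gz
  ... | true  = ⊥-elim (z≢z₀ (only z gz))
  ... | false = refl

∑-const : ∀ n k → ∑[ i < n ] k ≡ n * k
∑-const zero    k = refl
∑-const (suc n) k = cong (_+_ k) (∑-const n k)

foldr-tabulate : ∀ {a ℓ} (M : Monoid a ℓ) {n} (f : Fin n → Monoid.Carrier M) →
  foldr (Monoid._∙_ M) (Monoid.ε M) (tabulate f) ≡ RawMonoid.sum (Monoid.rawMonoid M) f
foldr-tabulate M {zero}  f = refl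
foldr-tabulate M {suc n} f = cong (Monoid._∙_ M (f Fin.zero)) (foldr-tabulate M (λ i → f (Fin.suc i)))

sum-allFin : ∀ {n} (f : Fin n → ℕ) → sum (map f (allFin n)) ≡ ∑ f
sum-allFin f = trans (cong sum (map-tabulate (λ i → i) f)) (foldr-tabulate ℕP.+-0-monoid f)

length-filter : ∀ {a p} {A : Set a} {P : A → Set p} (P? : ∀ x → Dec (P x)) (xs : List A) →
  length (filter P? xs) ≡ sum (map (λ x → χ (does (P? x))) xs)
length-filter P? []       = refl
length-filter P? (x ∷ xs) with does (P? x)
... | true  = cong suc (length-filter P? xs)
... | false = length-filter P? xs

sum-cartesianProduct : ∀ {a b} {A : Set a} {B : Set b} (f : A × B → ℕ) (xs : List A) (ys : List B) →
  sum (map f (cartesianProduct xs ys)) ≡ sum (map (λ x → sum (map (λ y → f (x , y)) ys)) xs)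
sum-cartesianProduct f []       ys = refl
sum-cartesianProduct f (x ∷ xs) ys = begin
  sum (map f (map (x ,_) ys ++ cartesianProduct xs ys))
    ≡⟨ cong sum (map-++ f (map (x ,_) ys) _) ⟩
  sum (map f (map (x ,_) ys) ++ map f (cartesianProduct xs ys))
    ≡⟨ sum-++ (map f (map (x ,_) ys)) _ ⟩
  sum (map f (map (x ,_) ys)) + sum (map f (cartesianProduct xs ys))
    ≡⟨ cong₂ _+_ (cong sum (sym (map-∘ ys))) (sum-cartesianProduct f xs ys) ⟩
  sum (map (λ y → f (x , y)) ys) + sum (map (λ x → sum (map (λ y → f (x , y)) ys)) xs) ∎

coord₁ coord₂ coord₃ : ∀ {n} → Triple n → Fin n
coord₁ (x , _ , _) = x
coord₂ (_ , y , _) = y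
coord₃ (_ , _ , z) = z

∑³ : ∀ {n} → (Triple n → ℕ) → ℕ
∑³ {n} F = ∑[ x < n ] ∑[ y < n ] ∑[ z < n ] F (x , y , z)

∑³-cong : ∀ {n} {F G : Triple n → ℕ} → (∀ t → F t ≡ G t) → ∑³ F ≡ ∑³ G
∑³-cong F≡G = sum-cong-≗ (λ x → sum-cong-≗ (λ y → sum-cong-≗ (λ z → F≡G (x , y , z))))

∑³-distrib-+ : ∀ {n} (F G : Triple n → ℕ) → ∑³ (λ t → F t + G t) ≡ ∑³ F + ∑³ G
∑³-distrib-+ {n} F G = trans
  (sum-cong-≗ (λ x → trans (sum-cong-≗ (λ y → ∑-distrib-+ (λ z → F (x , y , z)) (λ z → G (x , y , z))))
    (∑-distrib-+ (λ y → ∑[ z < n ] F (x , y , z)) (λ y → ∑[ z < n ] G (x , y , z)))))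
  (∑-distrib-+ (λ x → ∑[ y < n ] ∑[ z < n ] F (x , y , z)) (λ x → ∑[ y < n ] ∑[ z < n ] G (x , y , z)))

∑³-scale : ∀ {n} k (F : Triple n → ℕ) → ∑³ (λ t → k * F t) ≡ k * ∑³ F
∑³-scale {n} k F = sym (trans (*-distribˡ-sum k (λ x → ∑[ y < n ] ∑[ z < n ] F (x , y , z)))
  (sum-cong-≗ (λ x → trans (*-distribˡ-sum k (λ y → ∑[ z < n ] F (x , y , z)))
    (sum-cong-≗ (λ y → *-distribˡ-sum k (λ z → F (x , y , z)))))))

count-triples : ∀ {n} (b : Triple n → Bool) →
  length (filter (λ t → b t ≟ᵇ true) (allTriples n)) ≡ ∑³ (λ t → χ (b t))
count-triples {n} b = begin
  length (filter (λ t → b t ≟ᵇ true) (allTriples n))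
    ≡⟨ length-filter (λ t → b t ≟ᵇ true) (allTriples n) ⟩
  sum (map (λ t → χ (does (b t ≟ᵇ true))) (allTriples n))
    ≡⟨ cong sum (map-cong (λ t → cong χ (does-≟true (b t))) (allTriples n)) ⟩
  sum (map (λ t → χ (b t)) (allTriples n))
    ≡⟨ sum-cartesianProduct _ (allFin n) _ ⟩
  sum (map (λ x → sum (map (λ yz → χ (b (x , yz))) (cartesianProduct (allFin n) (allFin n)))) (allFin n))
    ≡⟨ cong sum (map-cong (λ x → sum-cartesianProduct _ (allFin n) (allFin n)) (allFin n)) ⟩
  sum (map (λ x → sum (map (λ y → sum (map (λ z → χ (b (x , y , z))) (allFin n))) (allFin n))) (allFin n))
    ≡⟨ sum-allFin³ ⟩
  ∑³ (λ t → χ (b t)) ∎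
  where
  sum-allFin³ : sum (map (λ x → sum (map (λ y → sum (map (λ z → χ (b (x , y , z))) (allFin n))) (allFin n))) (allFin n))
              ≡ ∑³ (λ t → χ (b t))
  sum-allFin³ = begin
    sum (map (λ x → sum (map (λ y → sum (map (λ z → χ (b (x , y , z))) (allFin n))) (allFin n))) (allFin n))
      ≡⟨ sum-allFin (λ x → sum (map (λ y → sum (map (λ z → χ (b (x , y , z))) (allFin n))) (allFin n))) ⟩
    ∑[ x < n ] sum (map (λ y → sum (map (λ z → χ (b (x , y , z))) (allFin n))) (allFin n))
      ≡⟨ sum-cong-≗ (λ x → sum-allFin (λ y → sum (map (λ z → χ (b (x , y , z))) (allFin n)))) ⟩
    ∑[ x < n ] ∑[ y < n ] sum (map (λ z → χ (b (x , y , z))) (allFin n))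
      ≡⟨ sum-cong-≗ (λ x → sum-cong-≗ (λ y → sum-allFin (λ z → χ (b (x , y , z))))) ⟩
    ∑³ (λ t → χ (b t)) ∎
  does-≟true : ∀ c → does (c ≟ᵇ true) ≡ c
  does-≟true true  = refl
  does-≟true false = refl

-- Three elements either all agree, or agree in exactly one pair, or are
-- pairwise distinct; counting agreeing pairs gives
--   2·[all agree] + 1 = [pairwise distinct] + [a=b] + [b=c] + [a=c].
module _ {ℓ} {A : Set ℓ} (_≟_ : DecidableEquality A) where

  colour-identity : ∀ a b c →
    2 * χ (does (a ≟ b) ∧ does (b ≟ c)) + 1 ≡
    χ (not (does (a ≟ b)) ∧ not (does (b ≟ c)) ∧ not (does (a ≟ c)))
      + χ (does (a ≟ b)) + χ (does (b ≟ c)) + χ (does (a ≟ c))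
  colour-identity a b c with a ≟ b | b ≟ c | a ≟ c
  ... | yes _   | yes _   | yes _   = refl
  ... | yes a=b | yes b=c | no a≠c  = ⊥-elim (a≠c (trans a=b b=c))
  ... | yes a=b | no b≠c  | yes a=c = ⊥-elim (b≠c (trans (sym a=b) a=c))
  ... | yes _   | no _    | no _    = refl
  ... | no a≠b  | yes b=c | yes a=c = ⊥-elim (a≠b (trans a=c (sym b=c)))
  ... | no _    | yes _   | no _    = refl
  ... | no _    | no _    | yes _   = refl
  ... | no _    | no _    | no _    = refl

  colour-identity-in : ∀ s a b c →
    2 * χ (s ∧ (does (a ≟ b) ∧ does (b ≟ c))) + χ s ≡
    χ (s ∧ (not (does (a ≟ b)) ∧ not (does (b ≟ c)) ∧ not (does (a ≟ c))))
      + χ (s ∧ does (a ≟ b)) + χ (s ∧ does (b ≟ c)) + χ (s ∧ does (a ≟ c))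
  colour-identity-in false a b c = refl
  colour-identity-in true  a b c = colour-identity a b c

-- A line of S (two coordinates fixed) holds exactly one vector of S, so
-- summing [t ∈ S ∧ b] along the line gives [b].
line-sum : ∀ {n} (g : Fin n → Bool) → ∃ (UniqueTrue g) → ∀ b → ∑[ z < n ] χ (g z ∧ b) ≡ χ b
line-sum g (_ , unique) b = trans (sum-cong-≗ (λ z → χ-∧ (g z) b)) (∑-select g (λ _ → χ b) unique)

-- Summing over S a relation e between two of the coordinates counts the
-- pairs related by e: each pair of values in two given positions extends
-- to exactly one vector of S.
module OrthogonalArraySums {n} (S : Sub3 n) (oa : IsOrthogonalArray-3-2 S) where

  pairCount : (Fin n → Fin n → Bool) → ℕ
  pairCount e = ∑[ a < n ] ∑[ b < n ] χ (e a b)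

  pairs₁₂ : ∀ e → ∑³ (λ t → χ (S t ∧ e (coord₁ t) (coord₂ t))) ≡ pairCount e
  pairs₁₂ e = sum-cong-≗ (λ x → sum-cong-≗ (λ y → line-sum _ (proj₁ oa x y) (e x y)))

  pairs₂₃ : ∀ e → ∑³ (λ t → χ (S t ∧ e (coord₂ t) (coord₃ t))) ≡ pairCount e
  pairs₂₃ e = trans (∑-comm (λ x y → ∑[ z < n ] χ (S (x , y , z) ∧ e y z)))
    (sum-cong-≗ (λ y → trans (∑-comm (λ x z → χ (S (x , y , z) ∧ e y z)))
      (sum-cong-≗ (λ z → line-sum _ (proj₂ (proj₂ oa) y z) (e y z)))))

  pairs₁₃ : ∀ e → ∑³ (λ t → χ (S t ∧ e (coord₁ t) (coord₃ t))) ≡ pairCount e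
  pairs₁₃ e = sum-cong-≗ (λ x → trans (∑-comm (λ y z → χ (S (x , y , z) ∧ e x z)))
    (sum-cong-≗ (λ z → line-sum _ (proj₁ (proj₂ oa) x z) (e x z))))

  size : ∑³ (λ t → χ (S t)) ≡ n * n
  size = begin
    ∑³ (λ t → χ (S t))                 ≡⟨ ∑³-cong (λ t → cong χ (sym (∧-identityʳ (S t)))) ⟩
    ∑³ (λ t → χ (S t ∧ true))          ≡⟨ pairs₁₂ (λ _ _ → true) ⟩
    ∑[ a < n ] ∑[ b < n ] 1            ≡⟨ sum-cong-≗ {n} (λ _ → ∑-const n 1) ⟩
    ∑[ a < n ] (n * 1)                 ≡⟨ ∑-const n (n * 1) ⟩
    n * (n * 1)                        ≡⟨ cong (_*_ n) (ℕP.*-identityʳ n) ⟩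
    n * n                              ∎

classSize-∑ : ∀ {n r} (col : Fin n → Fin r) (i : Fin r) →
  classSize col i ≡ ∑[ x < n ] χ (does (col x Fin.≟ i))
classSize-∑ {n} col i = trans (length-filter (λ x → col x Fin.≟ i) (allFin n)) (sum-allFin (λ x → χ (does (col x Fin.≟ i))))

sum-of-squares : ∀ {n r} (col : Fin n → Fin r) →
  ∑[ i < r ] (classSize col i * classSize col i) ≡ ∑[ x < n ] ∑[ y < n ] χ (sameColor col x y)
sum-of-squares {n} {r} col = begin
  ∑[ i < r ] (s i * s i)                        ≡⟨ sum-cong-≗ (λ i → cong (_* s i) (classSize-∑ col i)) ⟩
  ∑[ i < r ] (∑[ x < n ] [ x ∈ i ] * s i)       ≡⟨ sum-cong-≗ (λ i → *-distribʳ-sum (s i) (λ x → [ x ∈ i ])) ⟩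
  ∑[ i < r ] ∑[ x < n ] ([ x ∈ i ] * s i)       ≡⟨ ∑-comm (λ i x → [ x ∈ i ] * s i) ⟩
  ∑[ x < n ] ∑[ i < r ] ([ x ∈ i ] * s i)       ≡⟨ sum-cong-≗ (λ x → ∑-select (λ i → does (col x Fin.≟ i)) s (own-colour x)) ⟩
  ∑[ x < n ] s (col x)                          ≡⟨ sum-cong-≗ (λ x → classSize-∑ col (col x)) ⟩
  ∑[ x < n ] ∑[ y < n ] [ y ∈ col x ]           ≡⟨ ∑-comm (λ x y → [ y ∈ col x ]) ⟩
  ∑[ y < n ] ∑[ x < n ] χ (sameColor col y x)   ∎
  where
  s : Fin r → ℕ
  s = classSize col
  [_∈_] : Fin n → Fin r → ℕ
  [ x ∈ i ] = χ (does (col x Fin.≟ i))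
  own-colour : ∀ x → UniqueTrue (λ i → does (col x Fin.≟ i)) (col x)
  own-colour x = dec-true (col x Fin.≟ col x) refl , λ i same → sym (does⇒witness (col x Fin.≟ i) same)

counting-identity : ∀ {n r} (S : Sub3 n) → IsOrthogonalArray-3-2 S → (col : Fin n → Fin r) →
  2 * length (monoVectors S col) + n * n ≡
  length (rainbowVectors S col) + 3 * ∑[ i < r ] (classSize col i * classSize col i)
counting-identity {n} {r} S oa col = begin
  2 * length (monoVectors S col) + n * n
    ≡⟨ cong₂ (λ a b → 2 * a + b) (count-triples (λ t → S t ∧ isMonochromatic col t)) (sym size) ⟩
  2 * ∑³ mono + ∑³ member
    ≡⟨ cong (_+ ∑³ member) (sym (∑³-scale 2 mono)) ⟩
  ∑³ (λ t → 2 * mono t) + ∑³ member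
    ≡⟨ sym (∑³-distrib-+ (λ t → 2 * mono t) member) ⟩
  ∑³ (λ t → 2 * mono t + member t)
    ≡⟨ ∑³-cong (λ { (x , y , z) → colour-identity-in Fin._≟_ (S (x , y , z)) (col x) (col y) (col z) }) ⟩
  ∑³ (λ t → rainbow t + agree₁₂ t + agree₂₃ t + agree₁₃ t)
    ≡⟨ split-sum ⟩
  ∑³ rainbow + ∑³ agree₁₂ + ∑³ agree₂₃ + ∑³ agree₁₃
    ≡⟨ cong₄ (λ a b c d → a + b + c + d) (sym (count-triples (λ t → S t ∧ isRainbow col t)))
         (pairs₁₂ same) (pairs₂₃ same) (pairs₁₃ same) ⟩
  length (rainbowVectors S col) + Q + Q + Q
    ≡⟨ cong (λ q → length (rainbowVectors S col) + q + q + q) (sym (sum-of-squares col)) ⟩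
  length (rainbowVectors S col) + T + T + T
    ≡⟨ three-times (length (rainbowVectors S col)) T ⟩
  length (rainbowVectors S col) + 3 * T ∎
  where
  open OrthogonalArraySums S oa
  same : Fin n → Fin n → Bool
  same = sameColor col
  Q T : ℕ
  Q = pairCount same
  T = ∑[ i < r ] (classSize col i * classSize col i)
  mono member rainbow agree₁₂ agree₂₃ agree₁₃ : Triple n → ℕ
  mono t    = χ (S t ∧ isMonochromatic col t)
  member t  = χ (S t)
  rainbow t = χ (S t ∧ isRainbow col t)
  agree₁₂ t = χ (S t ∧ same (coord₁ t) (coord₂ t))
  agree₂₃ t = χ (S t ∧ same (coord₂ t) (coord₃ t))
  agree₁₃ t = χ (S t ∧ same (coord₁ t) (coord₃ t))
  split-sum : ∑³ (λ t → rainbow t + agree₁₂ t + agree₂₃ t + agree₁₃ t)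
            ≡ ∑³ rainbow + ∑³ agree₁₂ + ∑³ agree₂₃ + ∑³ agree₁₃
  split-sum = begin
    ∑³ (λ t → rainbow t + agree₁₂ t + agree₂₃ t + agree₁₃ t)
      ≡⟨ ∑³-distrib-+ (λ t → rainbow t + agree₁₂ t + agree₂₃ t) agree₁₃ ⟩
    ∑³ (λ t → rainbow t + agree₁₂ t + agree₂₃ t) + ∑³ agree₁₃
      ≡⟨ cong (_+ ∑³ agree₁₃) (∑³-distrib-+ (λ t → rainbow t + agree₁₂ t) agree₂₃) ⟩
    ∑³ (λ t → rainbow t + agree₁₂ t) + ∑³ agree₂₃ + ∑³ agree₁₃
      ≡⟨ cong (λ a → a + ∑³ agree₂₃ + ∑³ agree₁₃) (∑³-distrib-+ rainbow agree₁₂) ⟩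
    ∑³ rainbow + ∑³ agree₁₂ + ∑³ agree₂₃ + ∑³ agree₁₃ ∎
  three-times : ∀ a b → a + b + b + b ≡ a + 3 * b
  three-times = solve-∀
  cong₄ : ∀ {A : Set} (f : A → A → A → A → A) {a a′ b b′ c c′ d d′} →
          a ≡ a′ → b ≡ b′ → c ≡ c′ → d ≡ d′ → f a b c d ≡ f a′ b′ c′ d′
  cong₄ f refl refl refl refl = refl

ι : ℕ → ℚ
ι a = (+ a) / 1

module _ where
  open ℚᵘP.≃-Reasoning using (step-≈-⟩) renaming (begin_ to begin-≃_; _∎ to _∎-≃)

  toℚᵘ-/ : ∀ a k → ℚ.toℚᵘ ((+ a) / suc k) ℚᵘ.≃ mkℚᵘ (+ a) k
  toℚᵘ-/ a k = ℚP.toℚᵘ-fromℚᵘ (mkℚᵘ (+ a) k)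

  ι-+ : ∀ a b → ι (a + b) ≡ ι a ℚ.+ ι b
  ι-+ a b = ℚP.toℚᵘ-injective (begin-≃
    ℚ.toℚᵘ (ι (a + b))                  ≈⟨ toℚᵘ-/ (a + b) 0 ⟩
    mkℚᵘ (+ (a + b)) 0                   ≈⟨ *≡* (cong (ℤ._* + 1) integral) ⟩
    mkℚᵘ (+ a) 0 ℚᵘ.+ mkℚᵘ (+ b) 0       ≈⟨ ℚᵘP.≃-sym (ℚᵘP.+-cong (toℚᵘ-/ a 0) (toℚᵘ-/ b 0)) ⟩
    ℚ.toℚᵘ (ι a) ℚᵘ.+ ℚ.toℚᵘ (ι b)       ≈⟨ ℚᵘP.≃-sym (ℚP.toℚᵘ-homo-+ (ι a) (ι b)) ⟩
    ℚ.toℚᵘ (ι a ℚ.+ ι b)                 ∎-≃)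
    where
    integral : + (a + b) ≡ (+ a) ℤ.* (+ 1) ℤ.+ (+ b) ℤ.* (+ 1)
    integral = trans (ℤP.pos-+ a b) (sym (cong₂ ℤ._+_ (ℤP.*-identityʳ (+ a)) (ℤP.*-identityʳ (+ b))))

  ι-* : ∀ a b → ι (a * b) ≡ ι a *ℚ ι b
  ι-* a b = ℚP.toℚᵘ-injective (begin-≃
    ℚ.toℚᵘ (ι (a * b))                  ≈⟨ toℚᵘ-/ (a * b) 0 ⟩
    mkℚᵘ (+ (a * b)) 0                   ≈⟨ *≡* (cong (ℤ._* + 1) (ℤP.pos-* a b)) ⟩
    mkℚᵘ (+ a) 0 ℚᵘ.* mkℚᵘ (+ b) 0       ≈⟨ ℚᵘP.≃-sym (ℚᵘP.*-cong (toℚᵘ-/ a 0) (toℚᵘ-/ b 0)) ⟩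
    ℚ.toℚᵘ (ι a) ℚᵘ.* ℚ.toℚᵘ (ι b)       ≈⟨ ℚᵘP.≃-sym (ℚP.toℚᵘ-homo-* (ι a) (ι b)) ⟩
    ℚ.toℚᵘ (ι a *ℚ ι b)                  ∎-≃)

  ι-cancel : ∀ n s .{{_ : NonZero n}} → ι n *ℚ ((+ s) / n) ≡ ι s
  ι-cancel n@(suc k) s = ℚP.toℚᵘ-injective (begin-≃
    ℚ.toℚᵘ (ι n *ℚ ((+ s) / n))         ≈⟨ ℚP.toℚᵘ-homo-* (ι n) ((+ s) / n) ⟩
    ℚ.toℚᵘ (ι n) ℚᵘ.* ℚ.toℚᵘ ((+ s) / n) ≈⟨ ℚᵘP.*-cong (toℚᵘ-/ n 0) (toℚᵘ-/ s k) ⟩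
    mkℚᵘ (+ n) 0 ℚᵘ.* mkℚᵘ (+ s) k       ≈⟨ *≡* cross-multiplied ⟩
    mkℚᵘ (+ s) 0                         ≈⟨ ℚᵘP.≃-sym (toℚᵘ-/ s 0) ⟩
    ℚ.toℚᵘ (ι s)                         ∎-≃)
    where
    cross-multiplied : (+ n ℤ.* + s) ℤ.* + 1 ≡ + s ℤ.* + (1 * n)
    cross-multiplied = trans (ℤP.*-identityʳ (+ n ℤ.* + s))
      (trans (ℤP.*-comm (+ n) (+ s)) (cong (λ d → + s ℤ.* + d) (sym (ℕP.*-identityˡ n))))

sumℚ-∑ : ∀ r (f : Fin r → ℚ) → sumℚ r f ≡ ℚΣ.sum f
sumℚ-∑ r f = trans (cong (foldr ℚ._+_ ℚ.0ℚ) (map-tabulate (λ i → i) f)) (foldr-tabulate ℚP.+-0-monoid f)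

ι-∑ : ∀ {r} (f : Fin r → ℕ) → ι (∑ f) ≡ ℚΣ.sum (λ i → ι (f i))
ι-∑ {zero}  f = refl
ι-∑ {suc r} f = trans (ι-+ (f Fin.zero) _) (cong (ℚ._+_ (ι (f Fin.zero))) (ι-∑ (λ i → f (Fin.suc i))))

sum-of-squared-densities : ∀ n .{{_ : NonZero n}} r (s : Fin r → ℕ) →
  ι (n * n) *ℚ sumℚ r (λ i → ((+ s i) / n) *ℚ ((+ s i) / n)) ≡ ι (∑[ i < r ] (s i * s i))
sum-of-squared-densities n r s = begin
  ι (n * n) *ℚ sumℚ r (λ i → c i *ℚ c i)        ≡⟨ cong (ι (n * n) *ℚ_) (sumℚ-∑ r (λ i → c i *ℚ c i)) ⟩
  ι (n * n) *ℚ ℚΣ.sum (λ i → c i *ℚ c i)        ≡⟨ ℚΣ.*-distribˡ-sum (ι (n * n)) (λ i → c i *ℚ c i) ⟩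
  ℚΣ.sum (λ i → ι (n * n) *ℚ (c i *ℚ c i))      ≡⟨ ℚΣ.sum-cong-≗ (λ i → squared-density (s i)) ⟩
  ℚΣ.sum (λ i → ι (s i * s i))                  ≡⟨ sym (ι-∑ (λ i → s i * s i)) ⟩
  ι (∑[ i < r ] (s i * s i))                    ∎
  where
  open +-*-Solver
  c : Fin r → ℚ
  c i = (+ s i) / n
  interchange : ∀ a d → (a *ℚ a) *ℚ (d *ℚ d) ≡ (a *ℚ d) *ℚ (a *ℚ d)
  interchange = solve 2 (λ a d → (a :* a) :* (d :* d) := (a :* d) :* (a :* d)) refl
  squared-density : ∀ a → ι (n * n) *ℚ (((+ a) / n) *ℚ ((+ a) / n)) ≡ ι (a * a)
  squared-density a = begin
    ι (n * n) *ℚ (d *ℚ d)       ≡⟨ cong (_*ℚ (d *ℚ d)) (ι-* n n) ⟩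
    (ι n *ℚ ι n) *ℚ (d *ℚ d)    ≡⟨ interchange (ι n) d ⟩
    (ι n *ℚ d) *ℚ (ι n *ℚ d)    ≡⟨ cong₂ _*ℚ_ (ι-cancel n a) (ι-cancel n a) ⟩
    ι a *ℚ ι a                  ≡⟨ sym (ι-* a a) ⟩
    ι (a * a)                   ∎
    where
    d : ℚ
    d = (+ a) / n

theorem3p1 : (n : ℕ) → .{{_ : NonZero n}} → (S : Sub3 n) → IsOrthogonalArray-3-2 S →
    (r : ℕ) → (col : Fin n → Fin r) →
    let c : Fin r → ℚ
        c i = (+ classSize col i) / n
    in ((+ 2) / 1) *ℚ ((+ length (monoVectors S col)) / 1) - (+ length (rainbowVectors S col)) / 1
       ≡ ((+ (n * n)) / 1) *ℚ (((+ 3) / 1) *ℚ sumℚ r (λ i → c i *ℚ c i) - 1ℚ)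
theorem3p1 n S oa r col = begin
  ι 2 *ℚ ι m - ι R                              ≡⟨ balance (ι 2 *ℚ ι m) (ι R) (ι N) ⟩
  (ι 2 *ℚ ι m ℚ.+ ι N) - (ι R ℚ.+ ι N)          ≡⟨ cong (_- (ι R ℚ.+ ι N)) identity-in-ℚ ⟩
  (ι R ℚ.+ ι 3 *ℚ ι T) - (ι R ℚ.+ ι N)          ≡⟨ cong (λ t → (ι R ℚ.+ ι 3 *ℚ t) - (ι R ℚ.+ ι N)) squares ⟩
  (ι R ℚ.+ ι 3 *ℚ (ι N *ℚ Σc²)) - (ι R ℚ.+ ι N) ≡⟨ collect (ι R) (ι 3) (ι N) Σc² ⟩
  ι N *ℚ (ι 3 *ℚ Σc² - 1ℚ)                      ∎
  where
  open +-*-Solver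
  m R N T : ℕ
  m = length (monoVectors S col)
  R = length (rainbowVectors S col)
  N = n * n
  T = ∑[ i < r ] (classSize col i * classSize col i)
  Σc² : ℚ
  Σc² = sumℚ r (λ i → ((+ classSize col i) / n) *ℚ ((+ classSize col i) / n))
  identity-in-ℚ : ι 2 *ℚ ι m ℚ.+ ι N ≡ ι R ℚ.+ ι 3 *ℚ ι T
  identity-in-ℚ = begin
    ι 2 *ℚ ι m ℚ.+ ι N   ≡⟨ cong (ℚ._+ ι N) (sym (ι-* 2 m)) ⟩
    ι (2 * m) ℚ.+ ι N    ≡⟨ sym (ι-+ (2 * m) N) ⟩
    ι (2 * m + N)        ≡⟨ cong ι (counting-identity S oa col) ⟩
    ι (R + 3 * T)        ≡⟨ ι-+ R (3 * T) ⟩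
    ι R ℚ.+ ι (3 * T)    ≡⟨ cong (ℚ._+_ (ι R)) (ι-* 3 T) ⟩
    ι R ℚ.+ ι 3 *ℚ ι T   ∎
  squares : ι T ≡ ι N *ℚ Σc²
  squares = sym (sum-of-squared-densities n r (classSize col))
  balance : ∀ a b d → a - b ≡ (a ℚ.+ d) - (b ℚ.+ d)
  balance = solve 3 (λ a b d → a :- b := (a :+ d) :- (b :+ d)) refl
  collect : ∀ x t v w → (x ℚ.+ t *ℚ (v *ℚ w)) - (x ℚ.+ v) ≡ v *ℚ (t *ℚ w - 1ℚ)
  collect = solve 4 (λ x t v w → (x :+ t :* (v :* w)) :- (x :+ v) := v :* (t :* w :- con 1ℚ)) refl
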